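{- Let $A$, $B$, $B'$ be partitions (clusterings) of the finite set $\{1,\dots,n\}$. Then $B'$ is an $A$-consistent improvement of $B$ if and only if $B'$ can be obtained from $B$ by a sequence of perfect splits and perfect merges (each taken with respect to $A$).
   Context: A clustering of $\{1,\dots,n\}$ is a partition into nonempty disjoint clusters. A pair of distinct elements $\{v,w\}$ is an intra-cluster pair of a clustering if $v,w$ lie in the same cluster, and an inter-cluster pair otherwise. Two clusterings agree on a pair if the pair is intra-cluster in both or inter-cluster in both. $B'$ is an $A$-consistent improvement of $B$ iff $B\neq B'$ and every pair of elements on which $A$ and $B$ agree is also a pair on which $A$ and $B'$ agree. A perfect split (w.r.t. $A$): $B'$ is obtained from $B$ by splitting a single cluster $B_1$ of $B$ into two clusters $B_1',B_2'$ such that for every cluster $A_i$ of $A$, the set $A_i\cap B_1$ is a subset of either $B_1'$ or $B_2'$. A perfect merge (w.r.t. $A$): $B'$ is obtained from $B$ by merging two clusters $B_1,B_2$ of $B$ into one cluster $B_1\cup B_2$, where there is a cluster $A_i$ of $A$ with $B_1,B_2\subseteq A_i$. -}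

module Defs where

open import Data.Nat using (ℕ)
open import Data.Fin using (Fin)
open import Data.Bool using (Bool; true; false)
open import Data.Product using (Σ; ∃; _×_; _,_)
open import Data.Sum using (_⊎_)
open import Relation.Nullary using (¬_)
open import Relation.Binary.PropositionalEquality using (_≡_; _≢_)
open import Function.Bundles using (_⇔_)
open import Relation.Binary.Construct.Closure.Transitive using (TransClosure)

-- A clustering of {1,…,n} (= Fin n) is represented by a labelling of the
-- elements; its clusters are the nonempty fibres of the labelling.  Two
-- labellings represent the same partition iff they have the same
-- "same cluster" relation (see _≈C_).
Clustering : ℕ → Set
Clustering n = Fin n → ℕ

Same : ∀ {n} → Clustering n → Fin n → Fin n → Set
Same C v w = C v ≡ C w

_≈C_ : ∀ {n} → Clustering n → Clustering n → Set
B ≈C B' = ∀ v w → Same B v w ⇔ Same B' v w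

Agree : ∀ {n} → Clustering n → Clustering n → Fin n → Fin n → Set
Agree A B v w = Same A v w ⇔ Same B v w

ConsistentImprovement : ∀ {n} → Clustering n → Clustering n → Clustering n → Set
ConsistentImprovement A B B' =
  ¬ (B ≈C B') ×
  (∀ v w → v ≢ w → Agree A B v w → Agree A B' v w)

-- Perfect split w.r.t. A: the cluster B₁ of B containing c is split into
-- B₁' = {v ∈ B₁ | s v ≡ true} and B₂' = {v ∈ B₁ | s v ≡ false}, both
-- nonempty, every A_i ∩ B₁ lies on one side, all other clusters unchanged.
PerfectSplit : ∀ {n} → Clustering n → Clustering n → Clustering n → Set
PerfectSplit {n} A B B' =
  Σ (Fin n) λ c → Σ (Fin n → Bool) λ s →
    (Σ (Fin n) λ u → Same B u c × s u ≡ true) ×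
    (Σ (Fin n) λ u → Same B u c × s u ≡ false) ×
    (∀ v w → Same A v w → Same B v c → Same B w c → s v ≡ s w) ×
    (∀ v w → Same B' v w ⇔ (Same B v w × (Same B v c → s v ≡ s w)))

-- Perfect merge w.r.t. A: the two distinct clusters of B containing c and d
-- are merged; both are contained in a single cluster of A (the one of c);
-- all other clusters unchanged.
PerfectMerge : ∀ {n} → Clustering n → Clustering n → Clustering n → Set
PerfectMerge {n} A B B' =
  Σ (Fin n) λ c → Σ (Fin n) λ d →
    ¬ Same B c d ×
    (∀ v → (Same B v c ⊎ Same B v d) → Same A v c) ×
    (∀ v w → Same B' v w ⇔
       (Same B v w ⊎ ((Same B v c ⊎ Same B v d) × (Same B w c ⊎ Same B w d))))

PerfectStep : ∀ {n} → Clustering n → Clustering n → Clustering n → Set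
PerfectStep A B B' = PerfectSplit A B B' ⊎ PerfectMerge A B B'

Reachable : ∀ {n} → Clustering n → Clustering n → Clustering n → Set
Reachable A = TransClosure (PerfectStep A)

module Submission where

-- Soundness: a perfect step keeps every pair on which A and B agree and
-- gains a new one ("strict improvement"); this composes along sequences of
-- steps and implies B' ≉ B.
-- Completeness: while B ≉ B' (B' preserving the A-agreements of B), one
-- perfect step moves towards B': split a cluster of B that B' cuts, or, if B
-- refines B', merge two clusters that B' joins.  Such a step only changes a
-- pair to its status in both A and B' ("faithful"), so the invariant
-- survives and the number of pairs on which B and B' disagree decreases;
-- well-founded recursion on this distance gives the sequence of steps.

open import Defs
open import Data.Nat using (ℕ; zero; suc; _≤_; _<_; z≤n; s≤s; _≟_)
open import Data.Nat.Properties using (+-mono-≤; +-mono-<-≤; +-mono-≤-<; suc-injective; +-0-monoid)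
open import Data.Nat.Induction using (<-wellFounded)
open import Data.Fin using (Fin)
open import Data.Fin.Properties using (all?; any?; ¬∀⟶∃¬) renaming (_≟_ to _≟ᶠ_)
open import Data.Bool using (Bool; true; false) renaming (_≟_ to _≟ᵇ_)
open import Data.Product using (∃₂; _×_; _,_; proj₁; proj₂; uncurry)
open import Data.Sum using (_⊎_; inj₁; inj₂; [_,_])
open import Function using (_∘_; _on_)
open import Function.Bundles using (_⇔_; mk⇔; Equivalence)
import Function.Properties.Equivalence as ⇔
open import Relation.Nullary using (¬_; Dec; yes; no; does; map′; contradiction)
open import Relation.Nullary.Decidable using (_×-dec_; _→-dec_; ¬?; dec-true; dec-false; decidable-stable)
open import Relation.Binary.PropositionalEquality using (_≡_; _≢_; refl; sym; trans; cong₂)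
open import Relation.Binary.Construct.Closure.Transitive as TC using (_∷_)
open import Induction.WellFounded using (WellFounded; Acc; acc)
import Relation.Binary.Construct.On as On
open import Algebra.Properties.Monoid.Sum +-0-monoid using (sum; sum-syntax)

open Equivalence using (to; from)

both : ∀ {P Q : Set} → P → Q → P ⇔ Q
both p q = mk⇔ (λ _ → q) (λ _ → p)

neither : ∀ {P Q : Set} → ¬ P → ¬ Q → P ⇔ Q
neither ¬p ¬q = mk⇔ (λ p → contradiction p ¬p) (λ q → contradiction q ¬q)

same? : ∀ {n} (C : Clustering n) x y → Dec (Same C x y)
same? C x y = C x ≟ C y

agree? : ∀ {n} (C D : Clustering n) x y → Dec (Agree C D x y)
agree? C D x y = map′ (uncurry mk⇔) (λ e → to e , from e)
  ((same? C x y →-dec same? D x y) ×-dec (same? D x y →-dec same? C x y))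

≈C? : ∀ {n} (C D : Clustering n) → Dec (C ≈C D)
≈C? C D = all? (λ v → all? (λ w → agree? C D v w))

disagreement : ∀ {n} (C D : Clustering n) → ¬ (C ≈C D) → ∃₂ λ v w → ¬ Agree C D v w
disagreement {n} C D ¬C≈D with ¬∀⟶∃¬ n _ (λ v → all? (λ w → agree? C D v w)) ¬C≈D
... | v , ¬∀w with ¬∀⟶∃¬ n _ (λ w → agree? C D v w) ¬∀w
...   | w , ¬agr = v , w , ¬agr

-- An injective code of ℕ × Bool in ℕ, used to give the two halves of a
-- split cluster distinct labels.
tagged : ℕ → Bool → ℕ
tagged zero    false = 0
tagged zero    true  = 1
tagged (suc k) b     = suc (suc (tagged k b))

tagged-injective : ∀ k k' b b' → tagged k b ≡ tagged k' b' → k ≡ k' × b ≡ b'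
tagged-injective zero     zero     false false _ = refl , refl
tagged-injective zero     zero     true  true  _ = refl , refl
tagged-injective zero     zero     false true  ()
tagged-injective zero     zero     true  false ()
tagged-injective zero     (suc k') false _     ()
tagged-injective zero     (suc k') true  _     ()
tagged-injective (suc k)  zero     _     false ()
tagged-injective (suc k)  zero     _     true  ()
tagged-injective (suc k)  (suc k') b     b'    e
  with tagged-injective k k' b b' (suc-injective (suc-injective e))
... | refl , b≡b' = refl , b≡b'

splitBy : ∀ {n} → Clustering n → (Fin n → Bool) → Clustering n
splitBy C s u = tagged (C u) (s u)

splitBy-same : ∀ {n} (C : Clustering n) s x y →
  Same (splitBy C s) x y ⇔ (Same C x y × s x ≡ s y)
splitBy-same C s x y = mk⇔ (tagged-injective _ _ _ _) (λ (c , b) → cong₂ tagged c b)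

mergeAt : ∀ {n} → Clustering n → Fin n → Fin n → Clustering n
mergeAt C v w u with C u ≟ C w
... | yes _ = C v
... | no _  = C u

InPair : ∀ {n} → Clustering n → Fin n → Fin n → Fin n → Set
InPair C v w u = Same C u v ⊎ Same C u w

InPair-closed : ∀ {n} (C : Clustering n) v w x y →
  Same C x y → InPair C v w x → InPair C v w y
InPair-closed C v w x y xy (inj₁ xv) = inj₁ (trans (sym xy) xv)
InPair-closed C v w x y xy (inj₂ xw) = inj₂ (trans (sym xy) xw)

mergeAt-label : ∀ {n} (C : Clustering n) v w u →
  (InPair C v w u × mergeAt C v w u ≡ C v) ⊎ (¬ InPair C v w u × mergeAt C v w u ≡ C u)
mergeAt-label C v w u with C u ≟ C w
... | yes uw = inj₁ (inj₂ uw , refl)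
... | no ¬uw with C u ≟ C v
...   | yes uv = inj₁ (inj₁ uv , uv)
...   | no ¬uv = inj₂ ([ ¬uv , ¬uw ] , refl)

mergeAt-same : ∀ {n} (C : Clustering n) v w x y →
  Same (mergeAt C v w) x y ⇔ (Same C x y ⊎ (InPair C v w x × InPair C v w y))
mergeAt-same C v w x y with mergeAt-label C v w x | mergeAt-label C v w y
... | inj₁ (px , lx) | inj₁ (py , ly) =
  mk⇔ (λ _ → inj₂ (px , py)) (λ _ → trans lx (sym ly))
... | inj₁ (px , lx) | inj₂ (¬py , ly) =
  mk⇔ (λ e → contradiction (inj₁ (sym (trans (sym lx) (trans e ly)))) ¬py)
      [ (λ xy → contradiction (InPair-closed C v w x y xy px) ¬py) , (λ (_ , py) → contradiction py ¬py) ]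
... | inj₂ (¬px , lx) | inj₁ (py , ly) =
  mk⇔ (λ e → contradiction (inj₁ (trans (sym lx) (trans e ly))) ¬px)
      [ (λ xy → contradiction (InPair-closed C v w y x (sym xy) py) ¬px) , (λ (px , _) → contradiction px ¬px) ]
... | inj₂ (¬px , lx) | inj₂ (¬py , ly) =
  mk⇔ (λ e → inj₁ (trans (sym lx) (trans e ly)))
      [ (λ xy → trans lx (trans xy (sym ly))) , (λ (px , _) → contradiction px ¬px) ]

step-respects-≈C : ∀ {n} (A B B'' B' : Clustering n) →
  PerfectStep A B B'' → B'' ≈C B' → PerfectStep A B B'
step-respects-≈C A B B'' B' (inj₁ (c , s , t , f , pure , spec)) eq =
  inj₁ (c , s , t , f , pure , λ x y → ⇔.trans (⇔.sym (eq x y)) (spec x y))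
step-respects-≈C A B B'' B' (inj₂ (c , d , cd , pure , spec)) eq =
  inj₂ (c , d , cd , pure , λ x y → ⇔.trans (⇔.sym (eq x y)) (spec x y))

-- B' keeps every pair on which A and B agree (including the trivial
-- diagonal pairs, which ConsistentImprovement leaves out).
Preserves : ∀ {n} → Clustering n → Clustering n → Clustering n → Set
Preserves A B B' = ∀ x y → Agree A B x y → Agree A B' x y

preserves-off-diagonal : ∀ {n} (A B B' : Clustering n) →
  (∀ v w → v ≢ w → Agree A B v w → Agree A B' v w) → Preserves A B B'
preserves-off-diagonal A B B' pres x y agr with x ≟ᶠ y
... | yes refl = both refl refl
... | no x≢y = pres x y x≢y agr

StrictImprovement : ∀ {n} → Clustering n → Clustering n → Clustering n → Set
StrictImprovement {n} A B B' =
  Preserves A B B' × ∃₂ λ (x y : Fin n) → ¬ Agree A B x y × Agree A B' x y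

strict-improvement-trans : ∀ {n} (A B C D : Clustering n) →
  StrictImprovement A B C → StrictImprovement A C D → StrictImprovement A B D
strict-improvement-trans A B C D (presBC , x , y , ¬agrB , agrC) (presCD , _) =
  (λ u v → presCD u v ∘ presBC u v) , x , y , ¬agrB , presCD x y agrC

-- A perfect split only separates pairs that A separates; the two halves
-- provide a newly separated pair.
split-improves : ∀ {n} (A B B' : Clustering n) → PerfectSplit A B B' → StrictImprovement A B B'
split-improves A B B' (c , s , (u , uc , su) , (u' , u'c , su') , pure , spec) =
  preserves , u , u' , (λ e → ¬Auu' (from e (trans uc (sym u'c)))) , neither ¬Auu' ¬B'uu'
  where
  sides-differ : s u ≢ s u'
  sides-differ e = contradiction (trans (sym su) (trans e su')) λ ()
  ¬Auu' : ¬ Same A u u'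
  ¬Auu' a = sides-differ (pure u u' a uc u'c)
  ¬B'uu' : ¬ Same B' u u'
  ¬B'uu' b' = sides-differ (proj₂ (to (spec u u') b') uc)
  preserves : Preserves A B B'
  preserves x y agr = mk⇔
    (λ a → from (spec x y) (to agr a , λ xc → pure x y a xc (trans (sym (to agr a)) xc)))
    (λ b' → from agr (proj₁ (to (spec x y) b')))

-- A perfect merge only joins pairs that A joins; the two merged clusters
-- provide a newly joined pair.
merge-improves : ∀ {n} (A B B' : Clustering n) → PerfectMerge A B B' → StrictImprovement A B B'
merge-improves A B B' (c , d , ¬cd , pure , spec) =
  preserves , c , d , (λ e → ¬cd (to e Acd)) , both Acd (from (spec c d) (inj₂ (inj₁ refl , inj₂ refl)))
  where
  Acd : Same A c d
  Acd = sym (pure d (inj₂ refl))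
  preserves : Preserves A B B'
  preserves x y agr = mk⇔ (λ a → from (spec x y) (inj₁ (to agr a))) (joined ∘ to (spec x y))
    where
    joined : Same B x y ⊎ (InPair B c d x × InPair B c d y) → Same A x y
    joined (inj₁ b) = from agr b
    joined (inj₂ (px , py)) = trans (pure x px) (sym (pure y py))

step-improves : ∀ {n} (A B B' : Clustering n) → PerfectStep A B B' → StrictImprovement A B B'
step-improves A B B' (inj₁ split) = split-improves A B B' split
step-improves A B B' (inj₂ merge) = merge-improves A B B' merge

reachable-improves : ∀ {n} (A B B' : Clustering n) → Reachable A B B' → StrictImprovement A B B'
reachable-improves A B B' TC.[ st ] = step-improves A B B' st
reachable-improves A B B' (_∷_ {y = C} st rest) =
  strict-improvement-trans A B C B' (step-improves A B C st) (reachable-improves A C B' rest)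

-- A strict improvement differs from B as a partition, since it changes
-- the status of some pair.
strict⇒consistent : ∀ {n} (A B B' : Clustering n) →
  StrictImprovement A B B' → ConsistentImprovement A B B'
strict⇒consistent A B B' (pres , x , y , ¬agrB , agrB') =
  (λ eq → ¬agrB (⇔.trans agrB' (⇔.sym (eq x y)))) , (λ u v _ → pres u v)

sum-mono : ∀ {n} (f g : Fin n → ℕ) → (∀ i → f i ≤ g i) → sum f ≤ sum g
sum-mono {zero}  f g f≤g = z≤n
sum-mono {suc n} f g f≤g = +-mono-≤ (f≤g Fin.zero) (sum-mono _ _ (f≤g ∘ Fin.suc))

sum-< : ∀ {n} (f g : Fin n → ℕ) → (∀ i → f i ≤ g i) → (j : Fin n) → f j < g j → sum f < sum g
sum-< {suc n} f g f≤g Fin.zero    fj<gj = +-mono-<-≤ fj<gj (sum-mono _ _ (f≤g ∘ Fin.suc))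
sum-< {suc n} f g f≤g (Fin.suc j) fj<gj = +-mono-≤-< (f≤g Fin.zero) (sum-< _ _ (f≤g ∘ Fin.suc) j fj<gj)

defect : ∀ {P : Set} → Dec P → ℕ
defect (yes _) = 0
defect (no _)  = 1

defect-mono : ∀ {P Q : Set} (p? : Dec P) (q? : Dec Q) → (P → Q) → defect q? ≤ defect p?
defect-mono (yes p) (no ¬q) p→q = contradiction (p→q p) ¬q
defect-mono (yes _) (yes _) _   = z≤n
defect-mono (no _)  (yes _) _   = z≤n
defect-mono (no _)  (no _)  _   = s≤s z≤n

defect-< : ∀ {P Q : Set} (p? : Dec P) (q? : Dec Q) → ¬ P → Q → defect q? < defect p?
defect-< (yes p) _       ¬p _ = contradiction p ¬p
defect-< (no _)  (yes _) _  _ = s≤s z≤n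
defect-< (no _)  (no ¬q) _  q = contradiction q ¬q

module Completeness {n : ℕ} (A B' : Clustering n) where

  distance : Clustering n → ℕ
  distance C = ∑[ x < n ] ∑[ y < n ] defect (agree? C B' x y)

  distance-< : ∀ C C'' → (∀ x y → Agree C B' x y → Agree C'' B' x y) →
    ∀ x₀ y₀ → ¬ Agree C B' x₀ y₀ → Agree C'' B' x₀ y₀ → distance C'' < distance C
  distance-< C C'' closer x₀ y₀ ¬agr agr =
    sum-< _ _ (λ x → sum-mono _ _ (pairwise x)) x₀
      (sum-< _ _ (pairwise x₀) y₀ (defect-< (agree? C B' x₀ y₀) (agree? C'' B' x₀ y₀) ¬agr agr))
    where
    pairwise : ∀ x y → defect (agree? C'' B' x y) ≤ defect (agree? C B' x y)
    pairwise x y = defect-mono (agree? C B' x y) (agree? C'' B' x y) (closer x y)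

  Faithful : Clustering n → Clustering n → Fin n → Fin n → Set
  Faithful C C'' x y = Agree C C'' x y ⊎ (Agree C'' B' x y × Agree C'' A x y)

  faithful-preserves : ∀ C C'' → Preserves A C B' → (∀ x y → Faithful C C'' x y) → Preserves A C'' B'
  faithful-preserves C C'' pres faithful x y agr with faithful x y
  ... | inj₁ kept = pres x y (⇔.trans agr (⇔.sym kept))
  ... | inj₂ (toB' , toA) = ⇔.trans (⇔.sym toA) toB'

  faithful-closer : ∀ C C'' x y → Faithful C C'' x y → Agree C B' x y → Agree C'' B' x y
  faithful-closer C C'' x y (inj₁ kept)     agr = ⇔.trans (⇔.sym kept) agr
  faithful-closer C C'' x y (inj₂ (toB' , _)) _ = toB'

  record Advance (C : Clustering n) : Set where
    field
      next     : Clustering n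
      step     : PerfectStep A C next
      faithful : ∀ x y → Faithful C next x y
      x₀ y₀    : Fin n
      wasWrong : ¬ Agree C B' x₀ y₀
      nowRight : Agree next B' x₀ y₀

  advance-closer : ∀ C (adv : Advance C) → distance (Advance.next adv) < distance C
  advance-closer C adv = distance-< C next (λ x y → faithful-closer C next x y (faithful x y))
                                    x₀ y₀ wasWrong nowRight
    where open Advance adv

  -- If B' cuts the cluster of v in C (w ∈ C-cluster of v, w ∉ B'-cluster
  -- of v), split off the elements lying with v in both C and B'.
  module Split (C : Clustering n) (pres : Preserves A C B') (v w : Fin n)
               (Cvw : Same C v w) (¬B'vw : ¬ Same B' v w) where

    withV : ℕ → ℕ → Bool
    withV k k' = does ((k ≟ C v) ×-dec (k' ≟ B' v))

    side : Fin n → Bool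
    side u = withV (C u) (B' u)

    side-respects : ∀ x y → Same C x y → Same B' x y → side x ≡ side y
    side-respects x y = cong₂ withV

    side-outside : ∀ u → ¬ Same C u v → side u ≡ false
    side-outside u ¬Cuv = dec-false ((C u ≟ C v) ×-dec (B' u ≟ B' v)) (¬Cuv ∘ proj₁)

    next : Clustering n
    next = splitBy C side

    -- The split is perfect: a pair joined by A (hence by B') is not cut.
    pure : ∀ x y → Same A x y → Same C x v → Same C y v → side x ≡ side y
    pure x y Axy Cxv Cyv = side-respects x y Cxy (to (pres x y (both Axy Cxy)) Axy)
      where
      Cxy : Same C x y
      Cxy = trans Cxv (sym Cyv)

    spec : ∀ x y → Same next x y ⇔ (Same C x y × (Same C x v → side x ≡ side y))
    spec x y = ⇔.trans (splitBy-same C side x y)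
      (mk⇔ (λ (Cxy , e) → Cxy , λ _ → e) (λ (Cxy , e) → Cxy , sides Cxy e))
      where
      sides : Same C x y → (Same C x v → side x ≡ side y) → side x ≡ side y
      sides Cxy e with same? C x v
      ... | yes Cxv = e Cxv
      ... | no ¬Cxv = trans (side-outside x ¬Cxv)
                            (sym (side-outside y (λ Cyv → ¬Cxv (trans Cxy Cyv))))

    -- Cut pairs are separated by B' (they differ in side) and by A.
    faithful : ∀ x y → Faithful C next x y
    faithful x y with same? C x y | side x ≟ᵇ side y
    ... | no ¬Cxy  | _      = inj₁ (neither ¬Cxy (¬Cxy ∘ proj₁ ∘ to (splitBy-same C side x y)))
    ... | yes Cxy  | yes e  = inj₁ (both Cxy (from (splitBy-same C side x y) (Cxy , e)))
    ... | yes Cxy  | no ¬e  = inj₂ (neither ¬next ¬B'xy , neither ¬next ¬Axy)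
      where
      ¬next : ¬ Same next x y
      ¬next = ¬e ∘ proj₂ ∘ to (splitBy-same C side x y)
      ¬B'xy : ¬ Same B' x y
      ¬B'xy = ¬e ∘ side-respects x y Cxy
      ¬Axy : ¬ Same A x y
      ¬Axy Axy = ¬B'xy (to (pres x y (both Axy Cxy)) Axy)

    v-inside : side v ≡ true
    v-inside = dec-true ((C v ≟ C v) ×-dec (B' v ≟ B' v)) (refl , refl)

    w-outside : side w ≡ false
    w-outside = dec-false ((C w ≟ C v) ×-dec (B' w ≟ B' v)) (¬B'vw ∘ sym ∘ proj₂)

    result : Advance C
    result = record
      { next     = next
      ; step     = inj₁ (v , side , (v , refl , v-inside) , (w , sym Cvw , w-outside) , pure , spec)
      ; faithful = faithful
      ; x₀       = v
      ; y₀       = w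
      ; wasWrong = λ e → ¬B'vw (to e Cvw)
      ; nowRight = neither separated ¬B'vw
      }
      where
      separated : ¬ Same next v w
      separated e =
        contradiction (trans (sym v-inside) (trans (proj₂ (to (splitBy-same C side v w) e)) w-outside)) λ ()

  -- If C refines B' and B' joins two clusters of C (those of v and w),
  -- merge them.
  module Merge (C : Clustering n) (pres : Preserves A C B')
               (refines : ∀ x y → Same C x y → Same B' x y) (v w : Fin n)
               (¬Cvw : ¬ Same C v w) (B'vw : Same B' v w) where

    next : Clustering n
    next = mergeAt C v w

    -- A pair joined by B' but not by C is joined by A: otherwise A and C
    -- would agree on it, and so would A and B'.
    joined-by-A : ∀ x y → ¬ Same C x y → Same B' x y → Same A x y
    joined-by-A x y ¬Cxy B'xy =
      decidable-stable (same? A x y) (λ ¬Axy → ¬Axy (from (pres x y (neither ¬Axy ¬Cxy)) B'xy))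

    in-B'-cluster : ∀ u → InPair C v w u → Same B' u v
    in-B'-cluster u (inj₁ Cuv) = refines u v Cuv
    in-B'-cluster u (inj₂ Cuw) = trans (refines u w Cuw) (sym B'vw)

    pure : ∀ u → InPair C v w u → Same A u v
    pure u (inj₁ Cuv) = trans Auw (sym (joined-by-A v w ¬Cvw B'vw))
      where
      Auw : Same A u w
      Auw = joined-by-A u w (λ Cuw → ¬Cvw (trans (sym Cuv) Cuw)) (trans (refines u v Cuv) B'vw)
    pure u (inj₂ Cuw) = joined-by-A u v (λ Cuv → ¬Cvw (trans (sym Cuv) Cuw)) (in-B'-cluster u (inj₂ Cuw))

    -- Newly joined pairs are joined by B' and therefore by A.
    faithful : ∀ x y → Faithful C next x y
    faithful x y with same? C x y
    ... | yes Cxy = inj₁ (both Cxy (from (mergeAt-same C v w x y) (inj₁ Cxy)))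
    ... | no ¬Cxy with same? next x y
    ...   | no ¬next = inj₁ (neither ¬Cxy ¬next)
    ...   | yes nxt with to (mergeAt-same C v w x y) nxt
    ...     | inj₁ Cxy = contradiction Cxy ¬Cxy
    ...     | inj₂ (px , py) = inj₂ (both nxt B'xy , both nxt (joined-by-A x y ¬Cxy B'xy))
      where
      B'xy : Same B' x y
      B'xy = trans (in-B'-cluster x px) (sym (in-B'-cluster y py))

    result : Advance C
    result = record
      { next     = next
      ; step     = inj₂ (v , w , ¬Cvw , pure , mergeAt-same C v w)
      ; faithful = faithful
      ; x₀       = v
      ; y₀       = w
      ; wasWrong = λ e → ¬Cvw (from e B'vw)
      ; nowRight = both (from (mergeAt-same C v w v w) (inj₂ (inj₁ refl , inj₂ refl))) B'vw
      }

  advance : ∀ C → Preserves A C B' → ¬ (C ≈C B') → Advance C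
  advance C pres ¬C≈B' with any? (λ v → any? (λ w → same? C v w ×-dec ¬? (same? B' v w)))
  ... | yes (v , w , Cvw , ¬B'vw) = Split.result C pres v w Cvw ¬B'vw
  ... | no ¬cut with disagreement C B' ¬C≈B'
  ...   | v , w , ¬agr = Merge.result C pres refines v w ¬Cvw B'vw
    where
    -- No cluster of C is cut by B', so C refines B'; the disagreement
    -- is then a pair joined by B' only.
    refines : ∀ x y → Same C x y → Same B' x y
    refines x y Cxy = decidable-stable (same? B' x y) (λ ¬B'xy → ¬cut (x , y , Cxy , ¬B'xy))
    ¬Cvw : ¬ Same C v w
    ¬Cvw Cvw = ¬agr (both Cvw (refines v w Cvw))
    B'vw : Same B' v w
    B'vw = decidable-stable (same? B' v w) (λ ¬B'vw → ¬agr (neither ¬Cvw ¬B'vw))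

  distance-wellFounded : WellFounded (_<_ on distance)
  distance-wellFounded = On.wellFounded distance <-wellFounded

  reach : ∀ C → Acc (_<_ on distance) C → Preserves A C B' → ¬ (C ≈C B') → Reachable A C B'
  reach C (acc closer) pres ¬C≈B' with advance C pres ¬C≈B'
  ... | adv with ≈C? (Advance.next adv) B'
  ...   | yes arrived = TC.[ step-respects-≈C A C next B' step arrived ]
    where open Advance adv
  ...   | no ¬arrived =
    step ∷ reach next (closer (advance-closer C adv)) (faithful-preserves C next pres faithful) ¬arrived
    where open Advance adv

theorem4p6 : (n : ℕ) (A B B' : Clustering n) →
    ConsistentImprovement A B B' ⇔ Reachable A B B'
theorem4p6 n A B B' = mk⇔ complete sound
  where
  open Completeness A B' using (reach; distance-wellFounded)
  complete : ConsistentImprovement A B B' → Reachable A B B'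
  complete (¬B≈B' , pres) =
    reach B (distance-wellFounded B) (preserves-off-diagonal A B B' pres) ¬B≈B'
  sound : Reachable A B B' → ConsistentImprovement A B B'
  sound = strict⇒consistent A B B' ∘ reachable-improves A B B'
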